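{- Let $r \geq 1$ be an integer and $n = \frac{1}{2}(r^2 + 3r - 2)$. Then $\operatorname{diam}(\mathcal{R}_n) \geq n - \sqrt{n/2}$.
   Context: A binary string is called run-constrained if every run (maximal block) of consecutive $1$s in it is immediately followed by a run of $0$s of strictly greater length. For $n \geq 1$, the Fibonacci-run graph $\mathcal{R}_n$ has vertex set $\{ w \in \{0,1\}^n : w00 \text{ is a run-constrained string of length } n+2\}$, and two vertices are adjacent iff they differ in exactly one coordinate. $\operatorname{diam}(G)$ is the maximum graph distance between two vertices of $G$. -}

module Defs where

open import Data.Bool using (Bool; true; false; if_then_else_)
open import Data.Bool.Properties using () renaming (_≟_ to _≟B_)
open import Data.Nat using (ℕ; zero; suc; _<_; _≤_; _*_; _∸_; _^_)
open import Data.Product using (_×_; ∃; ∃-syntax; Σ-syntax)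
open import Data.List using (List; []; _∷_; _++_)
open import Data.Vec using (Vec; toList; lookup)
open import Data.Fin using (Fin)
open import Data.Unit using (⊤)
open import Data.Empty using (⊥)
open import Relation.Nullary using (¬_; does)
open import Relation.Binary.PropositionalEquality using (_≡_)

pushRun : Bool → List (Bool × ℕ) → List (Bool × ℕ)
pushRun b [] = (b Data.Product., 1) ∷ []
pushRun b ((c Data.Product., k) ∷ rs) =
  if does (b ≟B c) then (c Data.Product., suc k) ∷ rs
  else (b Data.Product., 1) ∷ (c Data.Product., k) ∷ rs

runs : List Bool → List (Bool × ℕ)
runs [] = []
runs (b ∷ w) = pushRun b (runs w)

RunsOK : List (Bool × ℕ) → Set
RunsOK [] = ⊤
RunsOK ((false Data.Product., _) ∷ rs) = RunsOK rs
RunsOK ((true Data.Product., k) ∷ []) = ⊥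
RunsOK ((true Data.Product., k) ∷ (true Data.Product., _) ∷ rs) = ⊥
RunsOK ((true Data.Product., k) ∷ (false Data.Product., m) ∷ rs) = (k < m) × RunsOK rs

RunConstrained : List Bool → Set
RunConstrained w = RunsOK (runs w)

-- vertex set of the Fibonacci-run graph R_n : w such that w00 is run-constrained
IsVertex : (n : ℕ) → Vec Bool n → Set
IsVertex n w = RunConstrained (toList w ++ (false ∷ false ∷ []))

Adj : (n : ℕ) → Vec Bool n → Vec Bool n → Set
Adj n u v = ∃[ i ] (¬ (lookup u i ≡ lookup v i) ×
                    (∀ (j : Fin n) → ¬ (j ≡ i) → lookup u j ≡ lookup v j))

data Walk (n : ℕ) : Vec Bool n → Vec Bool n → ℕ → Set where
  here : ∀ {u} → Walk n u u 0
  step : ∀ {u v w k} → IsVertex n v → Adj n u v → Walk n v w k → Walk n u w (suc k)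

-- dist_{R_n}(u,v) ≥ L for a real bound L given by a predicate on ℕ:
-- every walk from u to v has length satisfying the bound.
-- (If u, v are disconnected the distance is ∞ and this holds vacuously.)

-- "ℓ ≥ n - sqrt(n/2)" for a natural number ℓ, stated without reals:
-- equivalent to 2 (n ∸ ℓ)^2 ≤ n.
AtLeastNMinusSqrtHalfN : ℕ → ℕ → Set
AtLeastNMinusSqrtHalfN n ℓ = 2 * ((n ∸ ℓ) ^ 2) ≤ n

DiamAtLeastNMinusSqrtHalfN : ℕ → Set
DiamAtLeastNMinusSqrtHalfN n =
  Σ[ u ∈ Vec Bool n ] Σ[ v ∈ Vec Bool n ]
    (IsVertex n u × IsVertex n v ×
     (∀ {ℓ} → Walk n u v ℓ → AtLeastNMinusSqrtHalfN n ℓ))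

module Submission where

-- Prepending to a suffix alternating blocks of lengths 1, 2, …, r, one ending in
-- 1^r and the other in 0^r, gives two run-constrained words that differ in all
-- r(r+1)/2 positions of the prefix: each 1-block of length k is followed by a
-- 0-block of length k+1. Choosing the suffixes 0^(d+t) and 1^d 0^t with
-- r - 1 = d + t and t = ⌊(r-1)/2⌋ yields two vertices of R_n at Hamming distance
-- n - t with 2t² ≤ r(r+1)/2 ≤ n. A walk changes one coordinate per step, so
-- the Hamming distance bounds the graph distance from below.

open import Defs
open import Data.Bool using (Bool; true; false; not; _xor_; if_then_else_)
open import Data.Fin using (Fin; zero; suc)
open import Data.Fin.Properties using (suc-injective)
open import Data.List using (List; []; _∷_; _++_; replicate; length)
open import Data.List.Properties using (++-assoc; length-++; length-replicate)
open import Data.Nat using (ℕ; zero; suc; _+_; _*_; _∸_; _^_; _≤_; _<_; z≤n; s≤s; ⌊_/2⌋; ⌈_/2⌉)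
open import Data.Nat.Properties hiding (suc-injective)
open import Algebra.Properties.CommutativeSemigroup +-commutativeSemigroup
  using (interchange)
open import Data.Nat.Tactic.RingSolver using (solve-∀)
open import Data.Product using (Σ-syntax; _×_; _,_)
open import Relation.Nullary using (¬_)
open import Data.Unit using (tt)
open import Data.Vec using (Vec; toList; fromList; lookup; cast)
import Data.Vec as Vec
open import Data.Vec.Properties using (toList∘fromList; toList-cast; tabulate∘lookup; tabulate-cong)
open import Function using (_∘_)
open import Relation.Binary.PropositionalEquality
  using (_≡_; refl; sym; trans; cong; cong₂; subst; subst₂; module ≡-Reasoning)

mismatch : Bool → Bool → ℕ
mismatch a b = if a xor b then 1 else 0

mismatch-self : ∀ a → mismatch a a ≡ 0
mismatch-self true  = refl
mismatch-self false = refl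

mismatch-not : ∀ a → mismatch a (not a) ≡ 1
mismatch-not true  = refl
mismatch-not false = refl

mismatch-≤1 : ∀ a b → mismatch a b ≤ 1
mismatch-≤1 true  true  = z≤n
mismatch-≤1 true  false = ≤-refl
mismatch-≤1 false true  = ≤-refl
mismatch-≤1 false false = z≤n

mismatch-triangle : ∀ a b c → mismatch a c ≤ mismatch a b + mismatch b c
mismatch-triangle true  _     true  = z≤n
mismatch-triangle false _     false = z≤n
mismatch-triangle true  true  false = ≤-refl
mismatch-triangle true  false false = ≤-refl
mismatch-triangle false true  true  = ≤-refl
mismatch-triangle false false true  = ≤-refl

hamming : List Bool → List Bool → ℕ
hamming (a ∷ u) (b ∷ v) = mismatch a b + hamming u v
hamming _       _       = 0

hamming-self : ∀ u → hamming u u ≡ 0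
hamming-self []      = refl
hamming-self (a ∷ u) = cong₂ _+_ (mismatch-self a) (hamming-self u)

hamming-replicate-++ : ∀ k a b u v →
  hamming (replicate k a ++ u) (replicate k b ++ v) ≡ k * mismatch a b + hamming u v
hamming-replicate-++ zero    a b u v = refl
hamming-replicate-++ (suc k) a b u v =
  trans (cong (mismatch a b +_) (hamming-replicate-++ k a b u v))
        (sym (+-assoc (mismatch a b) (k * mismatch a b) (hamming u v)))

hamming-triangle : ∀ {n} (u w v : Vec Bool n) →
  hamming (toList u) (toList v) ≤ hamming (toList u) (toList w) + hamming (toList w) (toList v)
hamming-triangle Vec.[] Vec.[] Vec.[] = z≤n
hamming-triangle (a Vec.∷ u) (b Vec.∷ w) (c Vec.∷ v) = begin
  mismatch a c + hamming (toList u) (toList v)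
    ≤⟨ +-mono-≤ (mismatch-triangle a b c) (hamming-triangle u w v) ⟩
  (mismatch a b + mismatch b c) + (hamming (toList u) (toList w) + hamming (toList w) (toList v))
    ≡⟨ interchange (mismatch a b) (mismatch b c) _ _ ⟩
  (mismatch a b + hamming (toList u) (toList w)) + (mismatch b c + hamming (toList w) (toList v))
    ∎
  where open ≤-Reasoning

vec-ext : ∀ {n} {u v : Vec Bool n} → (∀ j → lookup u j ≡ lookup v j) → u ≡ v
vec-ext {u = u} {v} eq = begin
  u                       ≡⟨ sym (tabulate∘lookup u) ⟩
  Vec.tabulate (lookup u) ≡⟨ tabulate-cong eq ⟩
  Vec.tabulate (lookup v) ≡⟨ tabulate∘lookup v ⟩
  v                       ∎
  where open ≡-Reasoning

hamming-adjacent : ∀ {n} (u v : Vec Bool n) (i : Fin n) →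
  (∀ j → ¬ j ≡ i → lookup u j ≡ lookup v j) → hamming (toList u) (toList v) ≤ 1
hamming-adjacent (a Vec.∷ u) (b Vec.∷ v) zero agree
  rewrite vec-ext {u = u} {v} (λ j → agree (suc j) λ ())
        | hamming-self (toList v)
        | +-identityʳ (mismatch a b) = mismatch-≤1 a b
hamming-adjacent (a Vec.∷ u) (b Vec.∷ v) (suc i) agree
  rewrite agree zero (λ ()) | mismatch-self b =
  hamming-adjacent u v i (λ j j≢i → agree (suc j) (j≢i ∘ suc-injective))

walk-hamming : ∀ {n u v ℓ} → Walk n u v ℓ → hamming (toList u) (toList v) ≤ ℓ
walk-hamming {u = u} here = ≤-reflexive (hamming-self (toList u))
walk-hamming {u = u} {v} (step {v = w} _ (i , _ , agree) walk) =
  ≤-trans (hamming-triangle u w v)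
          (+-mono-≤ (hamming-adjacent u w i agree) (walk-hamming walk))

diameter-from-words : ∀ n (U V : List Bool) → length U ≡ n → length V ≡ n →
  RunConstrained (U ++ false ∷ false ∷ []) → RunConstrained (V ++ false ∷ false ∷ []) →
  2 * ((n ∸ hamming U V) ^ 2) ≤ n → DiamAtLeastNMinusSqrtHalfN n
diameter-from-words n U V ∣U∣≡n ∣V∣≡n U-ok V-ok bound =
  u , v , subst IsVertexWord (sym u≡U) U-ok , subst IsVertexWord (sym v≡V) V-ok , walk-bound
  where
  IsVertexWord : List Bool → Set
  IsVertexWord w = RunConstrained (w ++ false ∷ false ∷ [])
  u v : Vec Bool n
  u = cast ∣U∣≡n (fromList U)
  v = cast ∣V∣≡n (fromList V)
  u≡U : toList u ≡ U
  u≡U = trans (toList-cast ∣U∣≡n (fromList U)) (toList∘fromList U)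
  v≡V : toList v ≡ V
  v≡V = trans (toList-cast ∣V∣≡n (fromList V)) (toList∘fromList V)
  walk-bound : ∀ {ℓ} → Walk n u v ℓ → AtLeastNMinusSqrtHalfN n ℓ
  walk-bound {ℓ} walk = ≤-trans (*-monoʳ-≤ 2 (^-monoˡ-≤ 2 (∸-monoʳ-≤ n h≤ℓ))) bound
    where
    h≤ℓ : hamming U V ≤ ℓ
    h≤ℓ = subst₂ (λ U′ V′ → hamming U′ V′ ≤ ℓ) u≡U v≡V (walk-hamming walk)

runs-replicate-++ : ∀ k b y {m rs} → runs y ≡ (b , m) ∷ rs →
  runs (replicate k b ++ y) ≡ (b , k + m) ∷ rs
runs-replicate-++ zero    b     y e = e
runs-replicate-++ (suc k) true  y e rewrite runs-replicate-++ k true  y e = refl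
runs-replicate-++ (suc k) false y e rewrite runs-replicate-++ k false y e = refl

runs-zeros-++ : ∀ j x → RunConstrained x →
  Σ[ m ∈ ℕ ] Σ[ rs ∈ List (Bool × ℕ) ]
    runs (replicate (suc j) false ++ x) ≡ (false , suc j + m) ∷ rs × RunsOK rs
runs-zeros-++ zero x ok with runs x
... | []               = 0 , [] , refl , tt
... | (false , m) ∷ rs = m , rs , refl , ok
... | (true  , m) ∷ rs = 0 , (true , m) ∷ rs , refl , ok
runs-zeros-++ (suc j) x ok with runs-zeros-++ j x ok
... | m , rs , e , ok′ rewrite e = m , rs , refl , ok′

ones-++-constrained : ∀ k y {m rs} → runs y ≡ (false , m) ∷ rs → RunsOK rs → k < m →
  RunConstrained (replicate k true ++ y)
ones-++-constrained zero    y e ok _ = subst RunsOK (sym e) ok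
ones-++-constrained (suc k) y {m} {rs} e ok k<m =
  subst RunsOK (sym (ones e)) (k<m , ok)
  where
  ones : ∀ {j y} → runs y ≡ (false , m) ∷ rs →
    runs (replicate (suc j) true ++ y) ≡ (true , suc j) ∷ (false , m) ∷ rs
  ones {zero}  e rewrite e = refl
  ones {suc j} e = cong (pushRun true) (ones {j} e)

block-++-constrained : ∀ j x → RunConstrained x →
  RunConstrained (replicate j true ++ replicate (suc j) false ++ x)
block-++-constrained j x ok with runs-zeros-++ j x ok
... | m , rs , e , ok′ = ones-++-constrained j _ e ok′ (s≤s (m≤m+n j m))

triangular : ℕ → ℕ
triangular zero    = 0
triangular (suc k) = triangular k + suc k

-- ladder k b x = w₁ w₂ … wₖ x with wᵢ a block of length i and alternating letters; wₖ = b^k.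

ladder : ℕ → Bool → List Bool → List Bool
ladder zero    b x = x
ladder (suc j) b x = ladder j (not b) (replicate (suc j) b ++ x)

mutual
  ladder-true-constrained : ∀ k x → RunConstrained (replicate k true ++ x) →
    RunConstrained (ladder k true x)
  ladder-true-constrained zero    x ok = ok
  ladder-true-constrained (suc j) x ok = ladder-false-constrained j _ ok

  ladder-false-constrained : ∀ k x → RunConstrained x → RunConstrained (ladder k false x)
  ladder-false-constrained zero    x ok = ok
  ladder-false-constrained (suc j) x ok =
    ladder-true-constrained j _ (block-++-constrained j x ok)

hamming-outer-block : ∀ j b x y →
  triangular j + hamming (replicate (suc j) b ++ x) (replicate (suc j) (not b) ++ y)
    ≡ triangular (suc j) + hamming x y
hamming-outer-block j b x y = begin
  triangular j + hamming (replicate (suc j) b ++ x) (replicate (suc j) (not b) ++ y)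
    ≡⟨ cong (triangular j +_) (hamming-replicate-++ (suc j) b (not b) x y) ⟩
  triangular j + (suc j * mismatch b (not b) + hamming x y)
    ≡⟨ cong (λ c → triangular j + (c + hamming x y))
            (trans (cong (suc j *_) (mismatch-not b)) (*-identityʳ (suc j))) ⟩
  triangular j + (suc j + hamming x y)
    ≡⟨ sym (+-assoc (triangular j) (suc j) (hamming x y)) ⟩
  triangular (suc j) + hamming x y ∎
  where open ≡-Reasoning

ladder-++ : ∀ k b x y → ladder k b x ++ y ≡ ladder k b (x ++ y)
ladder-++ zero    b x y = refl
ladder-++ (suc j) b x y =
  trans (ladder-++ j (not b) _ y) (cong (ladder j (not b)) (++-assoc (replicate (suc j) b) x y))

length-ladder : ∀ k b x → length (ladder k b x) ≡ triangular k + length x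
length-ladder zero    b x = refl
length-ladder (suc j) b x = begin
  length (ladder j (not b) (replicate (suc j) b ++ x))
    ≡⟨ length-ladder j (not b) _ ⟩
  triangular j + length (replicate (suc j) b ++ x)
    ≡⟨ cong (triangular j +_) (length-++ (replicate (suc j) b)) ⟩
  triangular j + (length (replicate (suc j) b) + length x)
    ≡⟨ cong (λ l → triangular j + (l + length x)) (length-replicate (suc j)) ⟩
  triangular j + (suc j + length x)
    ≡⟨ sym (+-assoc (triangular j) (suc j) (length x)) ⟩
  triangular (suc j) + length x
    ∎
  where open ≡-Reasoning

hamming-ladder : ∀ k b x y → hamming (ladder k b x) (ladder k (not b) y) ≡ triangular k + hamming x y
hamming-ladder zero    b     x y = refl
hamming-ladder (suc j) true  x y = trans (hamming-ladder j false _ _) (hamming-outer-block j true x y)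
hamming-ladder (suc j) false x y = trans (hamming-ladder j true  _ _) (hamming-outer-block j false x y)

twice-triangular : ∀ k → 2 * triangular k ≡ k * suc k
twice-triangular zero    = refl
twice-triangular (suc k) = begin
  2 * (triangular k + suc k)        ≡⟨ *-distribˡ-+ 2 (triangular k) (suc k) ⟩
  2 * triangular k + 2 * suc k      ≡⟨ cong (_+ 2 * suc k) (twice-triangular k) ⟩
  k * suc k + 2 * suc k             ≡⟨ lemma k ⟩
  suc k * suc (suc k)               ∎
  where
  open ≡-Reasoning
  lemma : ∀ k → k * (1 + k) + 2 * (1 + k) ≡ (1 + k) * (2 + k)
  lemma = solve-∀

square-≤-triangular : ∀ t r → 2 * t ≤ r → 2 * t ^ 2 ≤ triangular r
square-≤-triangular t r 2t≤r = *-cancelˡ-≤ 2 (begin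
  2 * (2 * t ^ 2)     ≡⟨ lemma t ⟩
  (2 * t) * (2 * t)   ≤⟨ *-mono-≤ 2t≤r (m≤n⇒m≤1+n 2t≤r) ⟩
  r * suc r           ≡⟨ sym (twice-triangular r) ⟩
  2 * triangular r    ∎)
  where
  open ≤-Reasoning
  lemma : ∀ t → 2 * (2 * (t * (t * 1))) ≡ (2 * t) * (2 * t)
  lemma = solve-∀

vertex-count : ∀ m n → 2 * n ≡ (suc m * suc m + 3 * suc m) ∸ 2 → n ≡ triangular (suc m) + m
vertex-count m n 2n≡ = *-cancelˡ-≡ n (triangular (suc m) + m) 2 (begin
  2 * n                                          ≡⟨ 2n≡ ⟩
  (suc m * suc m + 3 * suc m) ∸ 2                ≡⟨ cong (_∸ 2) (lemma m) ⟩
  suc m * suc (suc m) + 2 * m                    ≡⟨ cong (_+ 2 * m) (twice-triangular (suc m)) ⟨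
  2 * triangular (suc m) + 2 * m                 ≡⟨ *-distribˡ-+ 2 (triangular (suc m)) m ⟨
  2 * (triangular (suc m) + m)                   ∎)
  where
  open ≡-Reasoning
  lemma : ∀ m → (1 + m) * (1 + m) + 3 * (1 + m) ≡ 2 + ((1 + m) * (2 + m) + 2 * m)
  lemma = solve-∀

triangular-diameter-bound : ∀ t d → t ≤ d → d ≤ suc t →
  DiamAtLeastNMinusSqrtHalfN (triangular (suc (d + t)) + (d + t))
triangular-diameter-bound t d t≤d d≤1+t =
  diameter-from-words n U V (length-word false) (length-word true) U-ok V-ok bound
  where
  r = suc (d + t)
  n = triangular r + (d + t)
  suffix : Bool → List Bool
  suffix b = replicate d b ++ replicate t false
  U V : List Bool
  U = ladder r true  (suffix false)
  V = ladder r false (suffix true)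

  length-word : ∀ b → length (ladder r (not b) (suffix b)) ≡ n
  length-word b = trans (length-ladder r (not b) (suffix b))
    (cong (triangular r +_) (trans (length-++ (replicate d b))
      (cong₂ _+_ (length-replicate d) (length-replicate t))))

  runs-zeros-00 : ∀ k → runs (replicate k false ++ false ∷ false ∷ []) ≡ (false , k + 2) ∷ []
  runs-zeros-00 k = runs-replicate-++ k false (false ∷ false ∷ []) refl

  U-ok : RunConstrained (U ++ false ∷ false ∷ [])
  U-ok rewrite ladder-++ r true (suffix false) (false ∷ false ∷ [])
             | ++-assoc (replicate d false) (replicate t false) (false ∷ false ∷ []) =
    ladder-true-constrained r _
      (ones-++-constrained r _ (runs-replicate-++ d false _ (runs-zeros-00 t)) tt
        (≤-reflexive (lemma d t)))
    where
    lemma : ∀ d t → 2 + (d + t) ≡ d + (t + 2)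
    lemma = solve-∀

  V-ok : RunConstrained (V ++ false ∷ false ∷ [])
  V-ok rewrite ladder-++ r false (suffix true) (false ∷ false ∷ [])
             | ++-assoc (replicate d true) (replicate t false) (false ∷ false ∷ []) =
    ladder-false-constrained r _
      (ones-++-constrained d _ (runs-zeros-00 t) tt (≤-trans (s≤s d≤1+t) (≤-reflexive (+-comm 2 t))))

  hamming-U-V : hamming U V ≡ triangular r + d
  hamming-U-V = begin
    hamming U V
      ≡⟨ hamming-ladder r true (suffix false) (suffix true) ⟩
    triangular r + hamming (suffix false) (suffix true)
      ≡⟨ cong (triangular r +_) (hamming-replicate-++ d false true _ _) ⟩
    triangular r + (d * 1 + hamming (replicate t false) (replicate t false))
      ≡⟨ cong₂ (λ a b → triangular r + (a + b)) (*-identityʳ d) (hamming-self (replicate t false)) ⟩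
    triangular r + (d + 0)
      ≡⟨ cong (triangular r +_) (+-identityʳ d) ⟩
    triangular r + d
      ∎
    where open ≡-Reasoning

  n∸hamming : n ∸ hamming U V ≡ t
  n∸hamming rewrite hamming-U-V | sym (+-assoc (triangular r) d t) = m+n∸m≡n (triangular r + d) t

  bound : 2 * ((n ∸ hamming U V) ^ 2) ≤ n
  bound rewrite n∸hamming =
    ≤-trans (square-≤-triangular t r (≤-trans (≤-reflexive (cong (t +_) (+-identityʳ t)))
                                               (m≤n⇒m≤1+n (+-monoˡ-≤ t t≤d))))
            (m≤m+n (triangular r) (d + t))

corollary5p2 : (r n : ℕ) → 1 ≤ r → 2 * n ≡ (r * r + 3 * r) ∸ 2 →
    DiamAtLeastNMinusSqrtHalfN n
corollary5p2 zero    n () _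
corollary5p2 (suc m) n _  2n≡ rewrite vertex-count m n 2n≡ =
  subst (λ k → DiamAtLeastNMinusSqrtHalfN (triangular (suc k) + k)) split
    (triangular-diameter-bound ⌊ m /2⌋ ⌈ m /2⌉ (⌊n/2⌋≤⌈n/2⌉ m) (⌊n/2⌋-mono (n≤1+n (suc m))))
  where
  split : ⌈ m /2⌉ + ⌊ m /2⌋ ≡ m
  split = trans (+-comm ⌈ m /2⌉ ⌊ m /2⌋) (⌊n/2⌋+⌈n/2⌉≡n m)
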